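{- For every integer $n\ge 1$, \[ F_{2n-2}=\sum_{j=0}^{\infty}\bigl[B(n,5j+2)-B(n,5j+3)\bigr]. \]
   Context: $F_n$ denotes the Fibonacci numbers, $F_0=0$, $F_1=1$, $F_{n}=F_{n-1}+F_{n-2}$. Consider lattice paths in $\mathbb{Z}^2$ starting at the origin and consisting of unit steps, each going East or North; the length of a path is its number of steps. The distance between two paths of length $n$ with endpoints $(a,b)$ and $(a',b')$ is $|a-a'|$. Two paths are non-intersecting if the origin is their only common point. For $1\le k\le n$, $B(n,k)$ is the number of pairs of non-intersecting paths of length $n$ at distance $k$ from one another (Catalan's triangle; e.g. $B(1,1)=1$, $B(2,1)=2$, $B(2,2)=1$, and $B(n,1)$ is the Catalan number $\frac{1}{n+1}\binom{2n}{n}$). Equivalently, $B(n,k)=\frac{k}{n}\binom{2n}{n-k}$. Set $B(n,k)=0$ for $k>n$. -}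

module Defs where

open import Data.Nat using (ℕ; zero; suc; _+_; _*_; _∸_; _≤ᵇ_)
open import Data.Nat.DivMod using (_/_)
open import Data.Nat.Combinatorics using (_C_)
open import Data.Bool using (if_then_else_)
open import Data.Integer as ℤ using (ℤ; +_; _-_)
open import Data.List using (List; map; foldr; upTo)

F : ℕ → ℕ
F zero = 0
F (suc zero) = 1
F (suc (suc n)) = F (suc n) + F n

-- Catalan's triangle: B(n,k) = (k/n) * binom(2n, n-k) for 1 ≤ k ≤ n,
-- and B(n,k) = 0 for k > n (and for k = 0 or n = 0, where it is unused).
-- The division by n is exact in the range 1 ≤ k ≤ n.
B : ℕ → ℕ → ℕ
B zero k = 0
B (suc m) zero = 0
B (suc m) (suc l) =
  if suc l ≤ᵇ suc m
  then (suc l * ((2 * suc m) C (suc m ∸ suc l))) / suc m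
  else 0

-- The infinite sum over j ≥ 0 of B(n,5j+2) - B(n,5j+3); all terms with
-- 5j+2 > n vanish, so it suffices to sum over j = 0 .. n.
altSum : ℕ → ℤ
altSum n = foldr ℤ._+_ (+ 0) (map (λ j → (+ B n (5 * j + 2)) - (+ B n (5 * j + 3))) (upTo (suc n)))

private
  open import Relation.Binary.PropositionalEquality using (_≡_; refl)
  t1 : B 2 1 ≡ 2
  t1 = refl
  t2 : B 5 2 ≡ 48
  t2 = refl
  t3 : altSum 6 ≡ + F 10
  t3 = refl
  t4 : altSum 7 ≡ + F 12
  t4 = refl

-- With n = m + 1, the Catalan triangle is a difference of adjacent binomials,
-- B(n, k) = C(2m+1, m+k) − C(2m+1, m+k+1), by the absorption identity; applying
-- Pascal's rule twice then gives B(n+1, k+1) = B(n, k) + 2 B(n, k+1) + B(n, k+2),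
-- and the symmetry of C(2m+1, ·) gives B(n, 0) = 0. Grouping k by residue mod 5,
-- D(n) = Σⱼ B(n,5j+2) − B(n,5j+3) and E(n) = Σⱼ B(n,5j+1) − B(n,5j+4) satisfy
-- D(n+1) = E(n) + D(n) and E(n+1) = 2 E(n) + D(n) + T(n), where
-- T(n) = Σⱼ B(n,5j) − B(n,5j+5) telescopes to B(n,0) = 0. From D(1) = 0 and
-- E(1) = 1 this is the Fibonacci recurrence: D(n) = F(2n−2), E(n) = F(2n−1).
module Submission where

open import Defs
open import Data.Nat using (ℕ; _*_; _∸_; _≤_)
open import Data.Integer using (+_)
open import Relation.Binary.PropositionalEquality using (_≡_)

open import Data.Bool using (true; false)
open import Data.Nat using (zero; suc; _+_; _<_; _≤ᵇ_; s≤s; z≤n; NonZero)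
open import Data.Nat.Properties
open import Data.Nat.DivMod using (_/_; m*n/n≡m)
open import Data.Nat.Combinatorics
  using (_C_; nCk+nC[k+1]≡[n+1]C[k+1]; nCk≡nC[n∸k]; nC1≡n; k>n⇒nCk≡0)
open import Data.Integer as ℤ using (ℤ; _-_)
import Data.Integer.Properties as ℤP
open import Data.List using (map; foldr; applyUpTo)
open import Data.Product using (_×_; _,_; proj₁; proj₂)
open import Function using (_∘_; id)
open import Relation.Nullary.Reflects using (ofʸ; ofⁿ)
open import Relation.Binary.PropositionalEquality using (refl; sym; trans; cong; cong₂; subst; module ≡-Reasoning)
import Data.Nat.Tactic.RingSolver as ℕ-Solver
import Data.Integer.Tactic.RingSolver as ℤ-Solver

open ≡-Reasoning

C-sym : ∀ a b → (a + b) C a ≡ (a + b) C b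
C-sym a b = trans (nCk≡nC[n∸k] (m≤m+n a b)) (cong ((a + b) C_) (m+n∸m≡n a b))

[k+1]*[n+1]C[k+1]≡[n+1]*nCk : ∀ n k → suc k * (suc n C suc k) ≡ suc n * (n C k)
[k+1]*[n+1]C[k+1]≡[n+1]*nCk n zero =
  trans (+-identityʳ (suc n C 1)) (trans (nC1≡n (suc n)) (sym (*-identityʳ (suc n))))
[k+1]*[n+1]C[k+1]≡[n+1]*nCk zero (suc k) = begin
  suc (suc k) * (1 C suc (suc k)) ≡⟨ cong (suc (suc k) *_) (k>n⇒nCk≡0 (s≤s (s≤s (z≤n {k})))) ⟩
  suc (suc k) * 0                 ≡⟨ *-zeroʳ (suc (suc k)) ⟩
  0                               ≡⟨ k>n⇒nCk≡0 (s≤s (z≤n {k})) ⟨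
  0 C suc k                       ≡⟨ *-identityˡ (0 C suc k) ⟨
  1 * (0 C suc k)                 ∎
[k+1]*[n+1]C[k+1]≡[n+1]*nCk (suc n) (suc k) = begin
  suc (suc k) * (suc (suc n) C suc (suc k))
    ≡⟨ cong (suc (suc k) *_) (nCk+nC[k+1]≡[n+1]C[k+1] (suc n) (suc k)) ⟨
  suc (suc k) * (X + Y)
    ≡⟨ distribute k X Y ⟩
  X + (suc k * X + suc (suc k) * Y)
    ≡⟨ cong (_+_ X) (cong₂ _+_ ([k+1]*[n+1]C[k+1]≡[n+1]*nCk n k)
                              ([k+1]*[n+1]C[k+1]≡[n+1]*nCk n (suc k))) ⟩
  X + (suc n * (n C k) + suc n * (n C suc k))
    ≡⟨ cong (_+_ X) (*-distribˡ-+ (suc n) (n C k) (n C suc k)) ⟨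
  X + suc n * (n C k + n C suc k)
    ≡⟨ cong (λ z → X + suc n * z) (nCk+nC[k+1]≡[n+1]C[k+1] n k) ⟩
  suc (suc n) * X ∎
  where
  X Y : ℕ
  X = suc n C suc k
  Y = suc n C suc (suc k)
  distribute : ∀ k x y → (2 + k) * (x + y) ≡ x + ((1 + k) * x + (2 + k) * y)
  distribute = ℕ-Solver.solve-∀

pascal-ℤ : ∀ n k → + (suc n C suc k) ≡ + (n C k) ℤ.+ + (n C suc k)
pascal-ℤ n k = trans (cong +_ (sym (nCk+nC[k+1]≡[n+1]C[k+1] n k))) (ℤP.pos-+ (n C k) (n C suc k))

pascal²-ℤ : ∀ n k →
  + (suc (suc n) C suc (suc k)) ≡
  + (n C k) ℤ.+ (+ (n C suc k) ℤ.+ + (n C suc k)) ℤ.+ + (n C suc (suc k))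
pascal²-ℤ n k = begin
  + (suc (suc n) C suc (suc k))
    ≡⟨ pascal-ℤ (suc n) (suc k) ⟩
  + (suc n C suc k) ℤ.+ + (suc n C suc (suc k))
    ≡⟨ cong₂ ℤ._+_ (pascal-ℤ n k) (pascal-ℤ n (suc k)) ⟩
  (+ (n C k) ℤ.+ + (n C suc k)) ℤ.+ (+ (n C suc k) ℤ.+ + (n C suc (suc k)))
    ≡⟨ regroup (+ (n C k)) (+ (n C suc k)) (+ (n C suc (suc k))) ⟩
  + (n C k) ℤ.+ (+ (n C suc k) ℤ.+ + (n C suc k)) ℤ.+ + (n C suc (suc k)) ∎
  where
  regroup : ∀ a b c → (a ℤ.+ b) ℤ.+ (b ℤ.+ c) ≡ a ℤ.+ (b ℤ.+ b) ℤ.+ c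
  regroup = ℤ-Solver.solve-∀

gap : ℕ → ℕ → ℤ
gap n k = + (n C k) - + (n C suc k)

gap-vanish : ∀ {n k} → n < k → gap n k ≡ + 0
gap-vanish n<k = cong₂ (λ x y → + x - + y) (k>n⇒nCk≡0 n<k) (k>n⇒nCk≡0 (m<n⇒m<1+n n<k))

gap-step : ∀ n k →
  gap (suc (suc n)) (suc (suc k)) ≡
  gap n k ℤ.+ (gap n (suc k) ℤ.+ gap n (suc k)) ℤ.+ gap n (suc (suc k))
gap-step n k = trans (cong₂ _-_ (pascal²-ℤ n k) (pascal²-ℤ n (suc k)))
  (regroup (+ (n C k)) (+ (n C suc k)) (+ (n C suc (suc k))) (+ (n C suc (suc (suc k)))))
  where
  regroup : ∀ a b c d → (a ℤ.+ (b ℤ.+ b) ℤ.+ c) - (b ℤ.+ (c ℤ.+ c) ℤ.+ d)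
                      ≡ (a - b) ℤ.+ ((b - c) ℤ.+ (b - c)) ℤ.+ (c - d)
  regroup = ℤ-Solver.solve-∀

ballot : ℕ → ℕ → ℤ
ballot m k = gap (m + suc m) (k + m)

ballot-zero : ∀ m → ballot m 0 ≡ + 0
ballot-zero m = trans (cong (λ x → + x - + ((m + suc m) C suc m)) (C-sym m (suc m)))
                      (ℤP.+-inverseʳ (+ ((m + suc m) C suc m)))

ballot-vanish : ∀ {m k} → suc m < k → ballot m k ≡ + 0
ballot-vanish {m} {k} m+1<k = gap-vanish (subst (_< k + m) (+-comm (suc m) m) (+-monoˡ-< m m+1<k))

ballot-step : ∀ m k →
  ballot (suc m) (suc k) ≡
  ballot m k ℤ.+ (ballot m (suc k) ℤ.+ ballot m (suc k)) ℤ.+ ballot m (suc (suc k))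
ballot-step m k = trans (cong₂ gap (cong suc (+-suc m (suc m))) (cong suc (+-suc k m)))
                        (gap-step (m + suc m) (k + m))

absorb-rearrange : ∀ n k x y → (k + n) * (x + y) ≡ (n + n) * x → k * (x + y) + n * y ≡ n * x
absorb-rearrange n k x y absorb = +-cancelˡ-≡ (n * x) _ _ (begin
  n * x + (k * (x + y) + n * y) ≡⟨ expand n k x y ⟩
  (k + n) * (x + y)             ≡⟨ absorb ⟩
  (n + n) * x                   ≡⟨ *-distribʳ-+ x n n ⟩
  n * x + n * x                 ∎)
  where
  expand : ∀ n k x y → n * x + (k * (x + y) + n * y) ≡ (k + n) * (x + y)
  expand = ℕ-Solver.solve-∀

/-difference : ∀ n .{{_ : NonZero n}} a x y → a + n * y ≡ n * x → + (a / n) ≡ + x - + y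
/-difference n a x y eq = begin
  + (a / n)             ≡⟨ cong (λ z → + (z / n)) a≡[x∸y]*n ⟩
  + ((x ∸ y) * n / n)   ≡⟨ cong +_ (m*n/n≡m (x ∸ y) n) ⟩
  + (x ∸ y)             ≡⟨ ℤP.⊖-≥ y≤x ⟨
  x ℤ.⊖ y               ≡⟨ ℤP.m-n≡m⊖n x y ⟨
  + x - + y             ∎
  where
  y≤x : y ≤ x
  y≤x = *-cancelˡ-≤ n (subst (n * y ≤_) eq (m≤n+m (n * y) a))
  a≡[x∸y]*n : a ≡ (x ∸ y) * n
  a≡[x∸y]*n = begin
    a                   ≡⟨ m+n∸n≡m a (n * y) ⟨
    a + n * y ∸ n * y   ≡⟨ cong (_∸ n * y) eq ⟩
    n * x ∸ n * y       ≡⟨ *-distribˡ-∸ n x y ⟨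
    n * (x ∸ y)         ≡⟨ *-comm n (x ∸ y) ⟩
    (x ∸ y) * n         ∎

ballot-formula : ∀ {l m} → l ≤ m →
  + ((suc l * ((2 * suc m) C (m ∸ l))) / suc m) ≡ ballot m (suc l)
ballot-formula {l} l≤m with m≤n⇒∃[o]m+o≡n l≤m
... | a , refl = begin
  + ((suc l * ((2 * suc m) C (m ∸ l))) / suc m)
    ≡⟨ cong (λ z → + ((suc l * ((2 * suc m) C z)) / suc m)) (m+n∸m≡n l a) ⟩
  + ((suc l * ((2 * suc m) C a)) / suc m)
    ≡⟨ cong (λ z → + ((suc l * z) / suc m)) middle ⟩
  + ((suc l * (X + Y)) / suc m)
    ≡⟨ /-difference (suc m) (suc l * (X + Y)) X Y (absorb-rearrange (suc m) (suc l) X Y absorb) ⟩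
  gap N j ∎
  where
  m N j X Y : ℕ
  m = l + a
  N = m + suc m
  j = suc l + m
  X = N C j
  Y = N C suc j
  size : 2 * suc m ≡ a + suc j
  size = lemma l a
    where
    lemma : ∀ l a → 2 * (1 + (l + a)) ≡ a + (2 + (l + (l + a)))
    lemma = ℕ-Solver.solve-∀
  middle : (2 * suc m) C a ≡ X + Y
  middle = begin
    (2 * suc m) C a      ≡⟨ cong (_C a) size ⟩
    (a + suc j) C a      ≡⟨ C-sym a (suc j) ⟩
    (a + suc j) C suc j  ≡⟨ cong (_C suc j) size ⟨
    (2 * suc m) C suc j  ≡⟨ cong (λ z → suc (m + z) C suc j) (+-identityʳ (suc m)) ⟩
    suc N C suc j        ≡⟨ nCk+nC[k+1]≡[n+1]C[k+1] N j ⟨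
    X + Y                ∎
  absorb : (suc l + suc m) * (X + Y) ≡ (suc m + suc m) * X
  absorb = begin
    (suc l + suc m) * (X + Y)  ≡⟨ cong₂ _*_ (+-suc (suc l) m) (nCk+nC[k+1]≡[n+1]C[k+1] N j) ⟩
    suc j * (suc N C suc j)    ≡⟨ [k+1]*[n+1]C[k+1]≡[n+1]*nCk N j ⟩
    (suc m + suc m) * X        ∎

ballot-B : ∀ m k → + B (suc m) k ≡ ballot m k
ballot-B m zero = sym (ballot-zero m)
ballot-B m (suc l) with suc l ≤ᵇ suc m | ≤ᵇ-reflects-≤ (suc l) (suc m)
... | true  | ofʸ (s≤s l≤m) = ballot-formula l≤m
... | false | ofⁿ l≰m      = sym (ballot-vanish (≰⇒> l≰m))

∑ : ℕ → (ℕ → ℤ) → ℤ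
∑ zero    f = + 0
∑ (suc n) f = f 0 ℤ.+ ∑ n (f ∘ suc)

foldr-map-applyUpTo : ∀ n (f : ℕ → ℤ) g →
  foldr ℤ._+_ (+ 0) (map f (applyUpTo g n)) ≡ ∑ n (f ∘ g)
foldr-map-applyUpTo zero    f g = refl
foldr-map-applyUpTo (suc n) f g = cong (ℤ._+_ (f (g 0))) (foldr-map-applyUpTo n f (g ∘ suc))

∑-cong : ∀ n {f g : ℕ → ℤ} → (∀ j → f j ≡ g j) → ∑ n f ≡ ∑ n g
∑-cong zero    f≗g = refl
∑-cong (suc n) f≗g = cong₂ ℤ._+_ (f≗g 0) (∑-cong n (f≗g ∘ suc))

∑-zero : ∀ n {f : ℕ → ℤ} → (∀ j → f j ≡ + 0) → ∑ n f ≡ + 0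
∑-zero zero    f≗0 = refl
∑-zero (suc n) f≗0 = cong₂ ℤ._+_ (f≗0 0) (∑-zero n (f≗0 ∘ suc))

∑-distrib-+ : ∀ n (f g : ℕ → ℤ) → ∑ n (λ j → f j ℤ.+ g j) ≡ ∑ n f ℤ.+ ∑ n g
∑-distrib-+ zero    f g = refl
∑-distrib-+ (suc n) f g = trans (cong (ℤ._+_ (f 0 ℤ.+ g 0)) (∑-distrib-+ n (f ∘ suc) (g ∘ suc)))
                                (interchange (f 0) (g 0) (∑ n (f ∘ suc)) (∑ n (g ∘ suc)))
  where
  interchange : ∀ a b c d → (a ℤ.+ b) ℤ.+ (c ℤ.+ d) ≡ (a ℤ.+ c) ℤ.+ (b ℤ.+ d)
  interchange = ℤ-Solver.solve-∀

∑-telescope : ∀ n (h : ℕ → ℤ) → ∑ n (λ j → h j - h (suc j)) ≡ h 0 - h n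
∑-telescope zero    h = sym (ℤP.+-inverseʳ (h 0))
∑-telescope (suc n) h = trans (cong (ℤ._+_ (h 0 - h 1)) (∑-telescope n (h ∘ suc)))
                              (cancel (h 0) (h 1) (h (suc n)))
  where
  cancel : ∀ a b c → (a - b) ℤ.+ (b - c) ≡ a - c
  cancel = ℤ-Solver.solve-∀

ballotDiff : ℕ → ℕ → ℕ → ℕ → ℤ
ballotDiff m a b j = ballot m (a + 5 * j) - ballot m (b + 5 * j)

ballotDiff-2-3-step : ∀ m j → ballotDiff (suc m) 2 3 j ≡ ballotDiff m 1 4 j ℤ.+ ballotDiff m 2 3 j
ballotDiff-2-3-step m j =
  trans (cong₂ _-_ (ballot-step m (1 + 5 * j)) (ballot-step m (2 + 5 * j)))
        (regroup (r 1) (r 2) (r 3) (r 4))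
  where
  r : ℕ → ℤ
  r a = ballot m (a + 5 * j)
  regroup : ∀ a b c d → (a ℤ.+ (b ℤ.+ b) ℤ.+ c) - (b ℤ.+ (c ℤ.+ c) ℤ.+ d) ≡ (a - d) ℤ.+ (b - c)
  regroup = ℤ-Solver.solve-∀

ballotDiff-1-4-step : ∀ m j →
  ballotDiff (suc m) 1 4 j ≡
  ballotDiff m 1 4 j ℤ.+ ballotDiff m 1 4 j ℤ.+ ballotDiff m 2 3 j ℤ.+ ballotDiff m 0 5 j
ballotDiff-1-4-step m j =
  trans (cong₂ _-_ (ballot-step m (5 * j)) (ballot-step m (3 + 5 * j)))
        (regroup (r 0) (r 1) (r 2) (r 3) (r 4) (r 5))
  where
  r : ℕ → ℤ
  r a = ballot m (a + 5 * j)
  regroup : ∀ a₀ a₁ a₂ a₃ a₄ a₅ →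
    (a₀ ℤ.+ (a₁ ℤ.+ a₁) ℤ.+ a₂) - (a₃ ℤ.+ (a₄ ℤ.+ a₄) ℤ.+ a₅)
      ≡ (a₁ - a₄) ℤ.+ (a₁ - a₄) ℤ.+ (a₂ - a₃) ℤ.+ (a₀ - a₅)
  regroup = ℤ-Solver.solve-∀

∑-ballotDiff-0-5 : ∀ N m → suc m < 5 * N → ∑ N (ballotDiff m 0 5) ≡ + 0
∑-ballotDiff-0-5 N m m+1<5N = begin
  ∑ N (ballotDiff m 0 5)              ≡⟨ ∑-cong N (λ j → cong (λ k → r j - ballot m k) (*-suc 5 j)) ⟨
  ∑ N (λ j → r j - r (suc j))         ≡⟨ ∑-telescope N r ⟩
  r 0 - r N                           ≡⟨ cong₂ _-_ (trans (cong (ballot m) (*-zeroʳ 5)) (ballot-zero m))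
                                                   (ballot-vanish m+1<5N) ⟩
  + 0                                 ∎
  where
  r : ℕ → ℤ
  r j = ballot m (5 * j)

∑-ballotDiff-2-3-step : ∀ N m →
  ∑ N (ballotDiff (suc m) 2 3) ≡ ∑ N (ballotDiff m 1 4) ℤ.+ ∑ N (ballotDiff m 2 3)
∑-ballotDiff-2-3-step N m =
  trans (∑-cong N (ballotDiff-2-3-step m)) (∑-distrib-+ N (ballotDiff m 1 4) (ballotDiff m 2 3))

∑-ballotDiff-1-4-step : ∀ N m → suc m < 5 * N →
  ∑ N (ballotDiff (suc m) 1 4) ≡
  ∑ N (ballotDiff m 1 4) ℤ.+ ∑ N (ballotDiff m 1 4) ℤ.+ ∑ N (ballotDiff m 2 3)
∑-ballotDiff-1-4-step N m m+1<5N = begin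
  ∑ N (ballotDiff (suc m) 1 4)
    ≡⟨ ∑-cong N (ballotDiff-1-4-step m) ⟩
  ∑ N (λ j → ballotDiff m 1 4 j ℤ.+ ballotDiff m 1 4 j ℤ.+ ballotDiff m 2 3 j ℤ.+ ballotDiff m 0 5 j)
    ≡⟨ ∑-distrib-+ N _ (ballotDiff m 0 5) ⟩
  ∑ N (λ j → ballotDiff m 1 4 j ℤ.+ ballotDiff m 1 4 j ℤ.+ ballotDiff m 2 3 j) ℤ.+ ∑ N (ballotDiff m 0 5)
    ≡⟨ cong₂ ℤ._+_ (trans (∑-distrib-+ N _ (ballotDiff m 2 3))
                          (cong (λ s → s ℤ.+ D) (∑-distrib-+ N (ballotDiff m 1 4) (ballotDiff m 1 4))))
                   (∑-ballotDiff-0-5 N m m+1<5N) ⟩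
  E ℤ.+ E ℤ.+ D ℤ.+ + 0
    ≡⟨ ℤP.+-identityʳ (E ℤ.+ E ℤ.+ D) ⟩
  E ℤ.+ E ℤ.+ D ∎
  where
  D E : ℤ
  D = ∑ N (ballotDiff m 2 3)
  E = ∑ N (ballotDiff m 1 4)

∑-ballotDiff≡F : ∀ N m → suc m < 5 * N →
  ∑ N (ballotDiff m 2 3) ≡ + F (2 * m) × ∑ N (ballotDiff m 1 4) ≡ + F (suc (2 * m))
∑-ballotDiff≡F (suc N) zero _ = D₀ , E₀
  where
  vanish : ∀ a b j → 1 < a + 5 * j → 1 < b + 5 * j → ballotDiff 0 a b j ≡ + 0
  vanish a b j 1<a+5j 1<b+5j = cong₂ _-_ (ballot-vanish 1<a+5j) (ballot-vanish 1<b+5j)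
  D₀ : ∑ (suc N) (ballotDiff 0 2 3) ≡ + 0
  D₀ = ∑-zero (suc N) (λ j → vanish 2 3 j (s≤s (s≤s z≤n)) (s≤s (s≤s z≤n)))
  E₀ : ∑ (suc N) (ballotDiff 0 1 4) ≡ + 1
  E₀ = cong (ℤ._+_ (ballotDiff 0 1 4 0))
         (∑-zero N (λ j → vanish 1 4 (suc j) (s≤s (s≤s z≤n)) (s≤s (s≤s z≤n))))
∑-ballotDiff≡F N (suc m) m+2<5N = D[m+1] , E[m+1]
  where
  m+1<5N : suc m < 5 * N
  m+1<5N = ≤-trans (n≤1+n _) m+2<5N
  IH : ∑ N (ballotDiff m 2 3) ≡ + F (2 * m) × ∑ N (ballotDiff m 1 4) ≡ + F (suc (2 * m))
  IH = ∑-ballotDiff≡F N m m+1<5N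
  D[m+1] : ∑ N (ballotDiff (suc m) 2 3) ≡ + F (2 * suc m)
  D[m+1] = begin
    ∑ N (ballotDiff (suc m) 2 3)                       ≡⟨ ∑-ballotDiff-2-3-step N m ⟩
    ∑ N (ballotDiff m 1 4) ℤ.+ ∑ N (ballotDiff m 2 3)  ≡⟨ cong₂ ℤ._+_ (proj₂ IH) (proj₁ IH) ⟩
    + F (suc (suc (2 * m)))                            ≡⟨ cong (+_ ∘ F) (*-suc 2 m) ⟨
    + F (2 * suc m)                                    ∎
  E[m+1] : ∑ N (ballotDiff (suc m) 1 4) ≡ + F (suc (2 * suc m))
  E[m+1] = begin
    ∑ N (ballotDiff (suc m) 1 4)
      ≡⟨ ∑-ballotDiff-1-4-step N m m+1<5N ⟩
    ∑ N (ballotDiff m 1 4) ℤ.+ ∑ N (ballotDiff m 1 4) ℤ.+ ∑ N (ballotDiff m 2 3)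
      ≡⟨ cong₂ ℤ._+_ (cong₂ ℤ._+_ (proj₂ IH) (proj₂ IH)) (proj₁ IH) ⟩
    + (F (suc (2 * m)) + F (suc (2 * m)) + F (2 * m))
      ≡⟨ cong +_ (regroup (F (suc (2 * m))) (F (2 * m))) ⟩
    + F (suc (suc (suc (2 * m))))
      ≡⟨ cong (+_ ∘ F ∘ suc) (*-suc 2 m) ⟨
    + F (suc (2 * suc m)) ∎
    where
    regroup : ∀ a b → a + a + b ≡ (a + b) + a
    regroup = ℕ-Solver.solve-∀

mainTheorem6 : (n : ℕ) → 1 ≤ n → (+ F (2 * n ∸ 2)) ≡ altSum n
mainTheorem6 zero    ()
mainTheorem6 (suc m) _ = begin
  + F (2 * suc m ∸ 2)        ≡⟨ cong (λ k → + F (k ∸ 2)) (*-suc 2 m) ⟩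
  + F (2 * m)                ≡⟨ proj₁ (∑-ballotDiff≡F (suc (suc m)) m m+1<5[m+2]) ⟨
  ∑ (suc (suc m)) (ballotDiff m 2 3)
    ≡⟨ ∑-cong (suc (suc m)) (λ j → cong₂ _-_ (B≡ballot 2 j) (B≡ballot 3 j)) ⟨
  ∑ (suc (suc m)) summand    ≡⟨ foldr-map-applyUpTo (suc (suc m)) summand id ⟨
  altSum (suc m)             ∎
  where
  summand : ℕ → ℤ
  summand j = + B (suc m) (5 * j + 2) - + B (suc m) (5 * j + 3)
  B≡ballot : ∀ a j → + B (suc m) (5 * j + a) ≡ ballot m (a + 5 * j)
  B≡ballot a j = trans (cong (+_ ∘ B (suc m)) (+-comm (5 * j) a)) (ballot-B m (a + 5 * j))
  m+1<5[m+2] : suc m < 5 * suc (suc m)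
  m+1<5[m+2] = s≤s (s≤s (m≤m+n m _))
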